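{- Define the sequence $c$ by $c(1)=2$ and, for $n\ge 2$, $$c(n)=c(n-1)+\begin{cases}\gcd(n,\,c(n-1)), & n \text{ even},\\ \gcd(n-2,\,c(n-1)), & n\text{ odd}.\end{cases}$$ Call $n$ a fundamental point if $c(n)=2n$, and list the fundamental points as $m_1<m_2<\cdots$. For adjacent fundamental points $m_i<m_{i+1}$, a minor increment between them is an integer $n$ with $m_i<n<m_{i+1}$, $n\neq m_i+3$ and $c(n)-c(n-1)>1$. Assume that for every $i\ge 3$ for which $m_{i+1}$ exists, every minor increment $n$ between $m_i$ and $m_{i+1}$ satisfies $n<m_{i+1}-\sqrt{m_{i+1}-1}-4$. Let $i\ge 2$ be such that $m_{i+1}$ exists, and put $p_1=m_i+1$, $p_2=m_{i+1}+1$ (the consecutive greater members of twin prime pairs produced by the fundamental points). Then $p_2\ge 2p_1-1$. -}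

module Defs where

open import Data.Nat using (ℕ; zero; suc; _+_; _*_; _∸_; _^_; _≤_; _<_; _%_; _≡ᵇ_)
open import Data.Nat.GCD using (gcd)
open import Data.Bool using (if_then_else_)
open import Data.Product using (_×_)
open import Relation.Binary.PropositionalEquality using (_≡_)

-- The sequence c, defined for n ≥ 1 (c 0 = 0 is a dummy value, never used):
--   c(1) = 2,
--   c(n) = c(n-1) + gcd(n, c(n-1))     if n even,
--   c(n) = c(n-1) + gcd(n-2, c(n-1))   if n odd,   for n ≥ 2.
c : ℕ → ℕ
c zero = 0
c (suc zero) = 2
c (suc (suc k)) =
  c (suc k) + (if (suc (suc k) % 2 ≡ᵇ 0)
                 then gcd (suc (suc k)) (c (suc k))
                 else gcd k (c (suc k)))

IsFundamental : ℕ → Set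
IsFundamental n = 1 ≤ n × c n ≡ 2 * n

countFund : ℕ → ℕ
countFund zero = 0
countFund (suc k) = countFund k + (if (c (suc k) ≡ᵇ 2 * suc k) then 1 else 0)

IsMth : ℕ → ℕ → Set
IsMth i m = IsFundamental m × countFund m ≡ i

MinorIncrement : ℕ → ℕ → ℕ → Set
MinorIncrement m m' n = m < n × n < m' × (n ≡ m + 3 → ⊥') × 1 < c n ∸ c (n ∸ 1)
  where open import Data.Empty renaming (⊥ to ⊥')

-- n < m' - sqrt(m' - 1) - 4 (over the reals), written over ℕ:
-- equivalent to  n + 4 < m'  and  m' - 1 < (m' - n - 4)^2.
BelowSqrtBound : ℕ → ℕ → Set
BelowSqrtBound m' n = n + 4 < m' × m' ∸ 1 < (m' ∸ (n + 4)) ^ 2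

-- Consecutive fundamental points m_i < m_{i+1} (i ≥ 2) satisfy 2 m_i ≤ m_{i+1},
-- hence p₂ = m_{i+1} + 1 ≥ 2 (m_i + 1) - 1 = 2 p₁ - 1.
--
-- Write  c(n+1) = c(n) + gcd(partner(n+1), c(n))  with  partner(n) = n for even n
-- and n - 2 for odd n.  The proof has two halves.
--
-- * Doubling.  If m = 6(k+1) is fundamental then c(m+1) = 2m+1, c(m+2) = 2m+2 and
--   c(m+3) = 3m+3 (two coprime steps, then gcd(m+1, 2m+2) = m+1).  Since c grows by
--   at least 1 per step, every later fundamental point m' satisfies
--   2m' = c(m') ≥ c(m+3) + (m' - m - 3), i.e. m' ≥ 2m.
-- * Invariance of "multiple of 6" (uses the hypothesis).  Between m = m_i and m' =
--   m_{i+1} the graph of c stays above the diagonal, so c(m'-1) = 2m'-1.  The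
--   hypothesis forbids increments > 1 at m'-4, …, m'-1, so c(m'-t) = 2m'-t for t ≤ 5.
--   If m' were odd, or ≡ 2, 4 (mod 6), then 2 or 3 would divide both partner(m'-t)
--   and c(m'-t-1) for t = 1, 3 or 4, contradicting the unit increment there.
--
-- With m_2 = 2, m_3 = 6, m_4 = 12, induction on i shows that every m_i (i ≥ 3) is a
-- positive multiple of 6, and the doubling half gives the theorem.
module Submission where

open import Defs
open import Data.Nat using (ℕ; _+_; _*_; _∸_; _≤_)
open import Data.Nat using (zero; suc; _<_; z≤n; s≤s; _%_; _≡ᵇ_; _≤′_; ≤′-refl; ≤′-step)
open import Data.Nat.Properties
open import Data.Nat.Divisibility
open import Data.Nat.DivMod using ([m+kn]%n≡m%n; m≡m%n+[m/n]*n; m%n<n; _/_)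
open import Data.Nat.GCD using (gcd; gcd[m,n]∣m; gcd-greatest; gcd[m,n]≢0)
open import Data.Nat.Coprimality using (Coprime; coprime⇒gcd≡1)
open import Data.Nat.Tactic.RingSolver using (solve-∀)
open import Data.Bool using (true; false; if_then_else_; T)
open import Data.Bool.Properties using (if-float)
open import Data.Unit using (tt)
open import Data.Product using (_×_; _,_; proj₁; proj₂; ∃-syntax)
open import Data.Sum using (_⊎_; inj₁; inj₂)
open import Data.Empty using (⊥; ⊥-elim)
open import Relation.Nullary using (¬_; yes; no; contradiction)
open import Relation.Binary.Definitions using (tri<; tri≈; tri>)
open import Relation.Binary.PropositionalEquality

partner : ℕ → ℕ
partner n = if n % 2 ≡ᵇ 0 then n else n ∸ 2

c-step : ∀ n → 1 ≤ n → c (suc n) ≡ c n + gcd (partner (suc n)) (c n)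
c-step (suc k) _ =
  cong (c (suc k) +_) (sym (if-float (λ x → gcd x (c (suc k))) (suc (suc k) % 2 ≡ᵇ 0)))

partner-even : ∀ n → n % 2 ≡ 0 → partner n ≡ n
partner-even n n-even = cong (λ r → if r ≡ᵇ 0 then n else n ∸ 2) n-even

partner-odd : ∀ n → n % 2 ≡ 1 → partner n ≡ n ∸ 2
partner-odd n n-odd = cong (λ r → if r ≡ᵇ 0 then n else n ∸ 2) n-odd

parity-period-6 : ∀ a q → (a + q * 6) % 2 ≡ a % 2
parity-period-6 a q =
  trans (cong (λ x → (a + x) % 2) (sym (*-assoc q 3 2))) ([m+kn]%n≡m%n a (q * 3) 2)

c-positive : ∀ n → 1 ≤ n → 1 ≤ c n
c-positive (suc zero) _ = s≤s z≤n
c-positive (suc (suc k)) _ = ≤-trans (c-positive (suc k) (s≤s z≤n)) (m≤m+n _ _)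

-- c is strictly increasing: every increment is a gcd with a nonzero number.
c-increases : ∀ n → 1 ≤ n → c n < c (suc n)
c-increases n n≥1 = subst (c n <_) (sym (c-step n n≥1)) (m<m+n (c n) gcd-positive)
  where
    gcd-positive : 0 < gcd (partner (suc n)) (c n)
    gcd-positive = n≢0⇒n>0 (gcd[m,n]≢0 (partner (suc n)) (c n) (inj₂ (m<n⇒n≢0 (c-positive n n≥1))))

-- Consequently c(n) - c(a) ≥ n - a for 1 ≤ a ≤ n (stated without subtraction).
c-growth : ∀ {a n} → 1 ≤ a → a ≤ n → c a + n ≤ c n + a
c-growth {a} a≥1 a≤n = go (≤⇒≤′ a≤n)
  where
    go : ∀ {n} → a ≤′ n → c a + n ≤ c n + a
    go ≤′-refl = ≤-refl
    go {suc n} (≤′-step a≤′n) = begin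
      c a + suc n        ≡⟨ +-suc (c a) n ⟩
      suc (c a + n)      ≤⟨ s≤s (go a≤′n) ⟩
      suc (c n) + a      ≤⟨ +-monoˡ-≤ a (c-increases n (≤-trans a≥1 (≤′⇒≤ a≤′n))) ⟩
      c (suc n) + a      ∎
      where open ≤-Reasoning

unit-step-coprime : ∀ n → 1 ≤ n → c (suc n) ≡ suc (c n) →
                    ∀ {d} → d ∣ partner (suc n) → d ∣ c n → d ≡ 1
unit-step-coprime n n≥1 unit {d} d∣partner d∣cn = ∣1⇒≡1 (subst (d ∣_) gcd≡1 (gcd-greatest d∣partner d∣cn))
  where
    gcd≡1 : gcd (partner (suc n)) (c n) ≡ 1
    gcd≡1 = +-cancelˡ-≡ (c n) _ _ (trans (sym (c-step n n≥1)) (trans unit (+-comm 1 (c n))))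

c-step-value : ∀ n {v x} → 1 ≤ n → c n ≡ v → partner (suc n) ≡ x → c (suc n) ≡ v + gcd x v
c-step-value n n≥1 refl refl = c-step n n≥1

∣-remainder : ∀ {d a r} q → d ∣ a → d ∣ a * q + r → d ∣ r
∣-remainder q d∣a d∣b = ∣m+n∣m⇒∣n d∣b (∣m⇒∣m*n q d∣a)

∣-progression : ∀ {d a b} q → d ∣ a → d ∣ b → d ∣ a + q * b
∣-progression q d∣a d∣b = ∣m∣n⇒∣m+n d∣a (∣n⇒∣m*n q d∣b)

increment-one : ∀ {a b} → a < b → b ∸ a ≤ 1 → b ≡ suc a
increment-one {a} {b} a<b small = ≤-antisym b≤1+a a<b
  where
    b≤1+a : b ≤ suc a
    b≤1+a = subst₂ _≤_ (m+[n∸m]≡n (<⇒≤ a<b)) (+-comm a 1) (+-monoʳ-≤ a small)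

countFund-fundamental : ∀ k → c (suc k) ≡ 2 * suc k → countFund (suc k) ≡ suc (countFund k)
countFund-fundamental k e with c (suc k) ≡ᵇ 2 * suc k | ≡⇒≡ᵇ _ _ e
... | true  | _ = +-comm (countFund k) 1
... | false | ()

countFund-step : ∀ k → (IsFundamental (suc k) × countFund (suc k) ≡ suc (countFund k))
                       ⊎ countFund (suc k) ≡ countFund k
countFund-step k with c (suc k) ≡ᵇ 2 * suc k in eq
... | true  = inj₁ ((s≤s z≤n , ≡ᵇ⇒≡ _ _ (subst T (sym eq) tt)) , +-comm (countFund k) 1)
... | false = inj₂ (+-identityʳ (countFund k))

countFund-mono : ∀ {a b} → a ≤ b → countFund a ≤ countFund b
countFund-mono a≤b = go (≤⇒≤′ a≤b)
  where
    go : ∀ {a b} → a ≤′ b → countFund a ≤ countFund b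
    go ≤′-refl = ≤-refl
    go (≤′-step a≤′b) = ≤-trans (go a≤′b) (m≤m+n _ _)

countFund-< : ∀ {a b} → a < b → IsFundamental b → countFund a < countFund b
countFund-< {a} {suc k} (s≤s a≤k) (_ , fund) =
  subst (countFund a <_) (sym (countFund-fundamental k fund)) (s≤s (countFund-mono a≤k))

i+1≡suc : ∀ i → i + 1 ≡ suc i
i+1≡suc i = +-comm i 1

mth-unique : ∀ {j a b} → IsMth j a → IsMth j b → a ≡ b
mth-unique {a = a} {b} (fa , ca) (fb , cb) with <-cmp a b
... | tri< a<b _ _ = ⊥-elim (<-irrefl (trans ca (sym cb)) (countFund-< a<b fb))
... | tri≈ _ a≡b _ = a≡b
... | tri> _ _ b<a = ⊥-elim (<-irrefl (trans cb (sym ca)) (countFund-< b<a fa))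

mth-increasing : ∀ {i m m'} → IsMth i m → IsMth (i + 1) m' → m < m'
mth-increasing {i} {m} {m'} (_ , cm) (_ , cm') = ≰⇒> m'≰m
  where
    m'≰m : ¬ (m' ≤ m)
    m'≰m m'≤m = 1+n≰n (subst₂ _≤_ (trans cm' (i+1≡suc i)) cm (countFund-mono m'≤m))

no-fundamental-between : ∀ {i m m' n} → IsMth i m → IsMth (i + 1) m' →
                         m < n → n < m' → c n ≢ 2 * n
no-fundamental-between {i} {m} {m'} {n} (_ , cm) (fm' , cm') m<n n<m' fund =
  1+n≰n (subst₂ _≤_ (cong (λ j → suc (suc j)) cm) (trans cm' (i+1≡suc i)) twice)
  where
    twice : suc (suc (countFund m)) ≤ countFund m'
    twice = ≤-trans (s≤s (countFund-< m<n (≤-trans (s≤s z≤n) m<n , fund))) (countFund-< n<m' fm')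

-- Every index j with 1 ≤ j ≤ countFund n is attained by some m_j (the count
-- increases in steps of one).
mth-exists : ∀ n j → 1 ≤ j → j ≤ countFund n → ∃[ m ] IsMth j m
mth-exists zero j j≥1 j≤0 = ⊥-elim (1+n≰n (≤-trans j≥1 j≤0))
mth-exists (suc k) j j≥1 j≤count with countFund-step k
... | inj₂ same = mth-exists k j j≥1 (subst (j ≤_) same j≤count)
... | inj₁ (fund , raised) with j ≟ suc (countFund k)
...   | yes refl = suc k , fund , raised
...   | no j≢ = mth-exists k j j≥1 (≤-pred (≤∧≢⇒< (subst (j ≤_) raised j≤count) j≢))

m₂ : IsMth 2 2
m₂ = (s≤s z≤n , refl) , refl

m₃ : IsMth 3 6
m₃ = (s≤s z≤n , refl) , refl

m₄ : IsMth 4 12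
m₄ = (s≤s z≤n , refl) , refl

off-diagonal : ∀ x {v} → c x ≡ v → v < 2 * x → c x ≢ 2 * x
off-diagonal _ refl below = <⇒≢ below

passes : ∀ x {n} → x ≤ n → c n ≡ 2 * n → c x ≢ 2 * x → suc x ≤ n
passes _ x≤n fund not-fund = ≤∧≢⇒< x≤n (λ x≡n → not-fund (subst (λ y → c y ≡ 2 * y) (sym x≡n) fund))

-- Once above the diagonal, c stays above it until the next fundamental point,
-- since it drops relative to the diagonal by at most 1 per step.
above-diagonal : ∀ {a N} → 1 ≤ a → 2 * a < c a → (∀ n → a < n → n < N → c n ≢ 2 * n) →
                 ∀ n → a ≤ n → n < N → 2 * n < c n
above-diagonal {a} {N} a≥1 base clear _ start = go (≤⇒≤′ start)
  where
    go : ∀ {n} → a ≤′ n → n < N → 2 * n < c n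
    go ≤′-refl _ = base
    go {suc n} (≤′-step a≤′n) n<N = ≤∧≢⇒< on-or-above (λ e → clear (suc n) (s≤s a≤n) n<N (sym e))
      where
        a≤n : a ≤ n
        a≤n = ≤′⇒≤ a≤′n
        on-or-above : 2 * suc n ≤ c (suc n)
        on-or-above = begin
          2 * suc n        ≡⟨ *-suc 2 n ⟩
          2 + 2 * n        ≤⟨ s≤s (go a≤′n (<-trans (n<1+n n) n<N)) ⟩
          suc (c n)        ≤⟨ c-increases n (≤-trans a≥1 a≤n) ⟩
          c (suc n)        ∎
          where open ≤-Reasoning

landing : ∀ p → 1 ≤ p → 2 * p < c p → c (suc p) ≡ 2 * suc p → c (suc p) ≡ suc (c p)
landing p p≥1 above fund = ≤-antisym (subst (_≤ suc (c p)) (sym (trans fund (*-suc 2 p))) (s≤s above))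
                                      (c-increases p p≥1)

-- The arithmetic behind doubling: from c(m+3) = 3m+3 ≤ 2n - (n - m - 3) follows n ≥ 2m.
doubling-arith : ∀ k n → (21 + k * 18) + n ≤ 2 * n + (9 + k * 6) → 2 * (6 + k * 6) ≤ n
doubling-arith k n growth = +-cancelʳ-≤ (9 + k * 6 + n) _ _ (subst₂ _≤_ (lhs k n) (rhs k n) growth)
  where
    lhs : ∀ k n → (21 + k * 18) + n ≡ 2 * (6 + k * 6) + (9 + k * 6 + n)
    lhs = solve-∀
    rhs : ∀ k n → 2 * n + (9 + k * 6) ≡ n + (9 + k * 6 + n)
    rhs = solve-∀

MultipleOfSix : ℕ → Set
MultipleOfSix m = ∃[ k ] m ≡ 6 + k * 6

module AfterMultipleOfSix (k : ℕ) (fund : c (6 + k * 6) ≡ 2 * (6 + k * 6)) where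

  -- gcd(m-1, 2m) = 1: a common divisor divides 2 and the odd number m-1.
  coprime-m-1 : Coprime (5 + k * 6) (2 * (6 + k * 6))
  coprime-m-1 {d} (d∣a , d∣b) = ∣1⇒≡1 (∣-remainder (2 + k * 3) d∣2 (subst (d ∣_) (odd k) d∣a))
    where
      double : ∀ k → 2 * (6 + k * 6) ≡ (5 + k * 6) * 2 + 2
      double = solve-∀
      odd : ∀ k → 5 + k * 6 ≡ 2 * (2 + k * 3) + 1
      odd = solve-∀
      d∣2 : d ∣ 2
      d∣2 = ∣-remainder 2 d∣a (subst (d ∣_) (double k) d∣b)

  c-m+1 : c (7 + k * 6) ≡ 13 + k * 12
  c-m+1 = begin
    c (7 + k * 6)                                      ≡⟨ c-step-value (6 + k * 6) (s≤s z≤n) fund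
                                                            (partner-odd (7 + k * 6) (parity-period-6 7 k)) ⟩
    2 * (6 + k * 6) + gcd (5 + k * 6) (2 * (6 + k * 6)) ≡⟨ cong (2 * (6 + k * 6) +_) (coprime⇒gcd≡1 coprime-m-1) ⟩
    2 * (6 + k * 6) + 1                                ≡⟨ arith k ⟩
    13 + k * 12                                        ∎
    where
      open ≡-Reasoning
      arith : ∀ k → 2 * (6 + k * 6) + 1 ≡ 13 + k * 12
      arith = solve-∀

  -- gcd(m+2, 2m+1) = 1: a common divisor divides 3 and m+2 ≡ 2 (mod 3).
  coprime-m+2 : Coprime (8 + k * 6) (13 + k * 12)
  coprime-m+2 {d} (d∣a , d∣b) = ∣1⇒≡1 (∣-remainder 1 d∣2 d∣3)
    where
      double : ∀ k → (8 + k * 6) * 2 ≡ (13 + k * 12) * 1 + 3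
      double = solve-∀
      split : ∀ k → 8 + k * 6 ≡ 3 * (2 + k * 2) + 2
      split = solve-∀
      d∣3 : d ∣ 3
      d∣3 = ∣-remainder 1 d∣b (subst (d ∣_) (double k) (∣m⇒∣m*n 2 d∣a))
      d∣2 : d ∣ 2
      d∣2 = ∣-remainder (2 + k * 2) d∣3 (subst (d ∣_) (split k) d∣a)

  c-m+2 : c (8 + k * 6) ≡ 14 + k * 12
  c-m+2 = begin
    c (8 + k * 6)                                ≡⟨ c-step-value (7 + k * 6) (s≤s z≤n) c-m+1
                                                      (partner-even (8 + k * 6) (parity-period-6 8 k)) ⟩
    (13 + k * 12) + gcd (8 + k * 6) (13 + k * 12) ≡⟨ cong ((13 + k * 12) +_) (coprime⇒gcd≡1 coprime-m+2) ⟩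
    (13 + k * 12) + 1                            ≡⟨ +-comm (13 + k * 12) 1 ⟩
    14 + k * 12                                  ∎
    where open ≡-Reasoning

  c-m+3 : c (9 + k * 6) ≡ 21 + k * 18
  c-m+3 = begin
    c (9 + k * 6)                                ≡⟨ c-step-value (8 + k * 6) (s≤s z≤n) c-m+2
                                                      (partner-odd (9 + k * 6) (parity-period-6 9 k)) ⟩
    (14 + k * 12) + gcd (7 + k * 6) (14 + k * 12) ≡⟨ cong ((14 + k * 12) +_) gcd-divisor ⟩
    (14 + k * 12) + (7 + k * 6)                  ≡⟨ arith k ⟩
    21 + k * 18                                  ∎
    where
      open ≡-Reasoning
      double : ∀ k → 14 + k * 12 ≡ 2 * (7 + k * 6)
      double = solve-∀
      gcd-divisor : gcd (7 + k * 6) (14 + k * 12) ≡ 7 + k * 6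
      gcd-divisor = ∣-antisym (gcd[m,n]∣m (7 + k * 6) (14 + k * 12)) (gcd-greatest ∣-refl (divides 2 (double k)))
      arith : ∀ k → (14 + k * 12) + (7 + k * 6) ≡ 21 + k * 18
      arith = solve-∀

  m+3-above-diagonal : 2 * (9 + k * 6) < c (9 + k * 6)
  m+3-above-diagonal = subst₂ _<_ (sym (double k)) (sym c-m+3)
                         (+-mono-≤ (m≤m+n 19 2) (*-monoʳ-≤ k (m≤m+n 12 6)))
    where
      double : ∀ k → 2 * (9 + k * 6) ≡ 18 + k * 12
      double = solve-∀

  doubling : ∀ {n} → 6 + k * 6 < n → c n ≡ 2 * n → 2 * (6 + k * 6) ≤ n
  doubling {n} m<n fund-n = doubling-arith k n growth
    where
      not-m+1 : c (7 + k * 6) ≢ 2 * (7 + k * 6)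
      not-m+1 = off-diagonal (7 + k * 6) c-m+1 (subst (13 + k * 12 <_) (double₇ k) ≤-refl)
        where
          double₇ : ∀ k → 14 + k * 12 ≡ 2 * (7 + k * 6)
          double₇ = solve-∀
      not-m+2 : c (8 + k * 6) ≢ 2 * (8 + k * 6)
      not-m+2 = off-diagonal (8 + k * 6) c-m+2 (subst (14 + k * 12 <_) (double₈ k) (n≤1+n (15 + k * 12)))
        where
          double₈ : ∀ k → 16 + k * 12 ≡ 2 * (8 + k * 6)
          double₈ = solve-∀
      m+3≤n : 9 + k * 6 ≤ n
      m+3≤n = passes (8 + k * 6) (passes (7 + k * 6) m<n fund-n not-m+1) fund-n not-m+2
      growth : (21 + k * 18) + n ≤ 2 * n + (9 + k * 6)
      growth = subst₂ (λ x y → x + n ≤ y + (9 + k * 6)) c-m+3 fund-n (c-growth (s≤s z≤n) m+3≤n)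

-- What is used of the hypothesis: no minor increment within distance 4 of m_{i+1}.
NoLateMinorIncrement : Set
NoLateMinorIncrement = ∀ i m m' n → 3 ≤ i → IsMth i m → IsMth (i + 1) m' →
                       MinorIncrement m m' n → n + 4 < m'

module NextPoint (H : NoLateMinorIncrement) (i k m' : ℕ) (i≥3 : 3 ≤ i)
                 (Mi : IsMth i (6 + k * 6)) (Mi' : IsMth (i + 1) m') (far : 14 + k * 6 ≤ m') where

  fund-m' : c m' ≡ 2 * m'
  fund-m' = proj₂ (proj₁ Mi')

  below-m' : ∀ p → 9 + k * 6 ≤ p → p < m' → 2 * p < c p
  below-m' = above-diagonal (s≤s z≤n) (AfterMultipleOfSix.m+3-above-diagonal k (proj₂ (proj₁ Mi)))
               (λ n m+3<n → no-fundamental-between Mi Mi' (≤-trans (+-monoˡ-≤ (k * 6) (m≤m+n 7 3)) m+3<n))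

  near-end : ∀ p t → p + t ≡ m' → t ≤ 5 → 9 + k * 6 ≤ p
  near-end p t e t≤5 = +-cancelʳ-≤ 5 (9 + k * 6) p
    (subst (_≤ p + 5) (+-comm 5 (9 + k * 6)) (≤-trans far (subst (_≤ p + 5) e (+-monoʳ-≤ p t≤5))))

  -- The last five increments before m' equal 1: the final one by landing,
  -- the others because a larger one would be a minor increment too close to m'.
  unit-near-end : ∀ p t → p + suc t ≡ m' → t ≤ 4 → c (suc p) ≡ suc (c p)
  unit-near-end p zero e _ =
    landing p (≤-trans (s≤s z≤n) p≥m+3) (below-m' p p≥m+3 (subst (p <_) e (m<m+n p (s≤s z≤n))))
            (trans (cong c sp≡m') (trans fund-m' (cong (2 *_) (sym sp≡m'))))
    where
      p≥m+3 : 9 + k * 6 ≤ p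
      p≥m+3 = near-end p 1 e (s≤s z≤n)
      sp≡m' : suc p ≡ m'
      sp≡m' = trans (+-comm 1 p) e
  unit-near-end p (suc t) e t≤4 = increment-one (c-increases p (≤-trans (s≤s z≤n) p≥m+3)) (≮⇒≥ not-minor)
    where
      p≥m+3 : 9 + k * 6 ≤ p
      p≥m+3 = near-end p (suc (suc t)) e (s≤s t≤4)
      m<n : 6 + k * 6 < suc p
      m<n = s≤s (≤-trans (+-monoˡ-≤ (k * 6) (m≤m+n 6 3)) p≥m+3)
      n<m' : suc p < m'
      n<m' = subst (suc p <_) e (subst (_≤ p + suc (suc t)) (+-comm p 2) (+-monoʳ-≤ p (s≤s (s≤s z≤n))))
      n≢m+3 : suc p ≢ (6 + k * 6) + 3
      n≢m+3 n≡m+3 = <-irrefl (sym (trans n≡m+3 (+-comm (6 + k * 6) 3))) (s≤s p≥m+3)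
      m'≤n+4 : m' ≤ suc p + 4
      m'≤n+4 = subst₂ _≤_ e (+-suc p 4) (+-monoʳ-≤ p (s≤s t≤4))
      not-minor : ¬ (1 < c (suc p) ∸ c p)
      not-minor big = <⇒≱ (H i (6 + k * 6) m' (suc p) i≥3 Mi Mi' (m<n , n<m' , n≢m+3 , big)) m'≤n+4

  tail : ∀ p t → p + t ≡ m' → t ≤ 5 → c p + t ≡ 2 * m'
  tail p zero e _ = trans (+-identityʳ (c p)) (subst (λ n → c n ≡ 2 * m') (sym p≡m') fund-m')
    where
      p≡m' : p ≡ m'
      p≡m' = trans (sym (+-identityʳ p)) e
  tail p (suc t) e (s≤s t≤4) = begin
    c p + suc t      ≡⟨ +-suc (c p) t ⟩
    suc (c p) + t    ≡⟨ cong (_+ t) (sym (unit-near-end p t e t≤4)) ⟩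
    c (suc p) + t    ≡⟨ tail (suc p) t (trans (sym (+-suc p t)) e) (≤-trans t≤4 (n≤1+n 4)) ⟩
    2 * m'           ∎
    where open ≡-Reasoning

  blocked : ∀ p t {v d} → p + suc t ≡ m' → t ≤ 4 → v + suc t ≡ 2 * m' →
            d ∣ partner (suc p) → d ∣ v → d ≡ 1
  blocked p t {v} {d} e t≤4 value d∣partner d∣v =
    unit-step-coprime p p≥1 (unit-near-end p t e t≤4) d∣partner (subst (d ∣_) v≡cp d∣v)
    where
      p≥1 : 1 ≤ p
      p≥1 = ≤-trans (s≤s z≤n) (near-end p (suc t) e (s≤s t≤4))
      v≡cp : v ≡ c p
      v≡cp = +-cancelʳ-≡ (suc t) v (c p) (trans value (sym (tail p (suc t) e (s≤s t≤4))))

  -- m' odd: 2 divides both partner(m'-1) = m'-1 and c(m'-2) = 2m'-2.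
  not-odd : ∀ b → m' ≡ 3 + b * 2 → ⊥
  not-odd b e = contradiction (blocked (1 + b * 2) 1 {4 + b * 4} {2}
                     (trans (position b) (sym e)) (s≤s z≤n) (trans (value b) (cong (2 *_) (sym e)))
                     (subst (2 ∣_) (sym (partner-even (2 + b * 2) ([m+kn]%n≡m%n 2 b 2)))
                        (∣-progression b (divides 1 refl) (divides 1 refl)))
                     (∣-progression b (divides 2 refl) (divides 2 refl))) (λ ())
    where
      position : ∀ b → (1 + b * 2) + 2 ≡ 3 + b * 2
      position = solve-∀
      value : ∀ b → (4 + b * 4) + 2 ≡ 2 * (3 + b * 2)
      value = solve-∀

  -- m' ≡ 2 (mod 6): 3 divides both partner(m'-3) = m'-5 and c(m'-4) = 2m'-4.
  not-2-mod-6 : ∀ q → m' ≡ 8 + q * 6 → ⊥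
  not-2-mod-6 q e = contradiction (blocked (4 + q * 6) 3 {12 + q * 12} {3}
                         (trans (position q) (sym e)) (s≤s (s≤s (s≤s z≤n))) (trans (value q) (cong (2 *_) (sym e)))
                         (subst (3 ∣_) (sym (partner-odd (5 + q * 6) (parity-period-6 5 q)))
                            (∣-progression q (divides 1 refl) (divides 2 refl)))
                         (∣-progression q (divides 4 refl) (divides 4 refl))) (λ ())
    where
      position : ∀ q → (4 + q * 6) + 4 ≡ 8 + q * 6
      position = solve-∀
      value : ∀ q → (12 + q * 12) + 4 ≡ 2 * (8 + q * 6)
      value = solve-∀

  -- m' ≡ 4 (mod 6): 3 divides both partner(m'-4) = m'-4 and c(m'-5) = 2m'-5.
  not-4-mod-6 : ∀ q → m' ≡ 10 + q * 6 → ⊥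
  not-4-mod-6 q e = contradiction (blocked (5 + q * 6) 4 {15 + q * 12} {3}
                         (trans (position q) (sym e)) (s≤s (s≤s (s≤s (s≤s z≤n)))) (trans (value q) (cong (2 *_) (sym e)))
                         (subst (3 ∣_) (sym (partner-even (6 + q * 6) (parity-period-6 6 q)))
                            (∣-progression q (divides 2 refl) (divides 2 refl)))
                         (∣-progression q (divides 5 refl) (divides 4 refl))) (λ ())
    where
      position : ∀ q → (5 + q * 6) + 5 ≡ 10 + q * 6
      position = solve-∀
      value : ∀ q → (15 + q * 12) + 5 ≡ 2 * (10 + q * 6)
      value = solve-∀

  odd-residue : ∀ r q → (3 + 2 * r) + q * 6 ≡ 3 + (r + q * 3) * 2
  odd-residue = solve-∀

  -- Case analysis on m' mod 6 (m' ≥ 14 excludes quotient 0).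
  residue : ∀ r q → r < 6 → m' ≡ r + q * 6 → MultipleOfSix m'
  residue r zero r<6 e =
    ⊥-elim (<⇒≱ r<6 (≤-trans (m≤m+n 6 (8 + k * 6)) (subst (14 + k * 6 ≤_) (trans e (+-identityʳ r)) far)))
  residue 0 (suc q) _ e = q , e
  residue 1 (suc q) _ e = ⊥-elim (not-odd (2 + q * 3) (trans e (odd-residue 2 q)))
  residue 2 (suc q) _ e = ⊥-elim (not-2-mod-6 q e)
  residue 3 (suc q) _ e = ⊥-elim (not-odd (3 + q * 3) (trans e (odd-residue 3 q)))
  residue 4 (suc q) _ e = ⊥-elim (not-4-mod-6 q e)
  residue 5 (suc q) _ e = ⊥-elim (not-odd (4 + q * 3) (trans e (odd-residue 4 q)))
  residue (suc (suc (suc (suc (suc (suc _)))))) _ (s≤s (s≤s (s≤s (s≤s (s≤s (s≤s ())))))) _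

  multiple-of-six : MultipleOfSix m'
  multiple-of-six = residue (m' % 6) (m' / 6) (m%n<n m' 6) (m≡m%n+[m/n]*n m' 6)

far-from-m : ∀ k → 14 + suc k * 6 ≤ 2 * (6 + suc k * 6)
far-from-m k = subst (14 + suc k * 6 ≤_) (sym (split k)) (m≤m+n (20 + k * 6) (4 + k * 6))
  where
    split : ∀ k → 2 * (6 + suc k * 6) ≡ (20 + k * 6) + (4 + k * 6)
    split = solve-∀

-- The successor of a fundamental multiple of six is again one.  For m = 6 = m_3
-- the successor is m_4 = 12; for larger m, doubling puts m' far enough from m
-- for the analysis near m'.
six-step : NoLateMinorIncrement → ∀ {i m m'} → 3 ≤ i → IsMth i m → IsMth (i + 1) m' →
           MultipleOfSix m → MultipleOfSix m'
six-step H {i} {m' = m'} i≥3 Mi Mi' (zero , refl) = 1 , mth-unique Mi₄ m₄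
  where
    Mi₄ : IsMth 4 m'
    Mi₄ = subst (λ j → IsMth (j + 1) m') (sym (proj₂ Mi)) Mi'
six-step H {i} {m' = m'} i≥3 Mi Mi' (suc k , refl) =
  NextPoint.multiple-of-six H i (suc k) m' i≥3 Mi Mi' (≤-trans (far-from-m k) doubled)
  where
    doubled : 2 * (6 + suc k * 6) ≤ m'
    doubled = AfterMultipleOfSix.doubling (suc k) (proj₂ (proj₁ Mi)) (mth-increasing Mi Mi') (proj₂ (proj₁ Mi'))

fundamental-multiple-of-six : NoLateMinorIncrement → ∀ j {m} → IsMth (3 + j) m → MultipleOfSix m
fundamental-multiple-of-six H zero Mm = 0 , mth-unique Mm m₃
fundamental-multiple-of-six H (suc j) {m} Mm
  with mth-exists m (3 + j) (s≤s z≤n) (subst (3 + j ≤_) (sym (proj₂ Mm)) (n≤1+n (3 + j)))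
... | m₀ , M₀ = six-step H (s≤s (s≤s (s≤s z≤n))) M₀ Mm' (fundamental-multiple-of-six H j M₀)
  where
    Mm' : IsMth ((3 + j) + 1) m
    Mm' = subst (λ j' → IsMth j' m) (sym (i+1≡suc (3 + j))) Mm

next-point-doubles : NoLateMinorIncrement → ∀ {i m m'} → 2 ≤ i → IsMth i m → IsMth (i + 1) m' → 2 * m ≤ m'
next-point-doubles H {suc zero} (s≤s ()) Mi Mi'
next-point-doubles H {suc (suc zero)} _ Mi Mi' with mth-unique Mi m₂ | mth-unique Mi' m₃
... | refl | refl = m≤m+n 4 2
next-point-doubles H {suc (suc (suc j))} _ Mi Mi' with fundamental-multiple-of-six H j Mi
... | k , refl = AfterMultipleOfSix.doubling k (proj₂ (proj₁ Mi)) (mth-increasing Mi Mi') (proj₂ (proj₁ Mi'))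

twin-prime-bound : ∀ {m m'} → 2 * m ≤ m' → 2 * (m + 1) ∸ 1 ≤ m' + 1
twin-prime-bound {m} {m'} 2m≤m' = subst (λ x → x ∸ 1 ≤ m' + 1) (sym (double m)) (+-monoˡ-≤ 1 2m≤m')
  where
    double : ∀ m → 2 * (m + 1) ≡ suc (2 * m + 1)
    double = solve-∀

corollary2 :
  (∀ i m m' n → 3 ≤ i → IsMth i m → IsMth (i + 1) m' →
    MinorIncrement m m' n → BelowSqrtBound m' n) →
  ∀ i m m' → 2 ≤ i → IsMth i m → IsMth (i + 1) m' →
    2 * (m + 1) ∸ 1 ≤ m' + 1
corollary2 H i m m' 2≤i Mi Mi' = twin-prime-bound {m} (next-point-doubles no-late 2≤i Mi Mi')
  where
    -- Only the first half of the bound n < m' - √(m'-1) - 4 is needed.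
    no-late : NoLateMinorIncrement
    no-late i m m' n i≥3 Mi Mi' minor = proj₁ (H i m m' n i≥3 Mi Mi' minor)
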